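{- Let $k\geq 3$ be odd, and let $G_k$ be the graph with vertex set $\{u,w,v_0,v_1,\ldots,v_{3k-1}\}$ and edge set $\{v_0v_1,v_1v_2,\ldots,v_{3k-2}v_{3k-1},v_{3k-1}v_0\}\cup\{uv_i : i\equiv 1 \text{ or } 2 \pmod 3\}\cup\{wv_i : i\equiv 0 \text{ or } 1 \pmod 3\}$ (indices $i\in\{0,\ldots,3k-1\}$). Then $G_k$ is uniquely 3-colorable.
   Context: A graph $G$ is uniquely $k$-colorable if its chromatic number is $k$ and $G$ has only one proper $k$-coloring up to permutation of the colors. -}

module Defs where

open import Data.Nat using (ℕ; suc; _*_; _≤_; _%_)
open import Data.Fin using (Fin; toℕ)
open import Data.Fin.Permutation using (Permutation′; _⟨$⟩ʳ_)
open import Data.Product using (Σ; ∃; _×_)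
open import Data.Sum using (_⊎_)
open import Data.Empty using (⊥)
open import Relation.Binary.PropositionalEquality using (_≡_; _≢_)

IsProperColoring : {V : Set} (Adj : V → V → Set) (c : ℕ) → (V → Fin c) → Set
IsProperColoring {V} Adj c f = (x y : V) → Adj x y → f x ≢ f y

Colorable : {V : Set} (Adj : V → V → Set) (c : ℕ) → Set
Colorable {V} Adj c = Σ (V → Fin c) (IsProperColoring Adj c)

HasChromaticNumber : {V : Set} (Adj : V → V → Set) (k : ℕ) → Set
HasChromaticNumber Adj k = Colorable Adj k × ((c : ℕ) → Colorable Adj c → k ≤ c)

UniquelyColorable : {V : Set} (Adj : V → V → Set) (k : ℕ) → Set
UniquelyColorable {V} Adj k =
  HasChromaticNumber Adj k ×
  ((f g : V → Fin k) → IsProperColoring Adj k f → IsProperColoring Adj k g →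
     ∃ λ (π : Permutation′ k) → (x : V) → g x ≡ π ⟨$⟩ʳ f x)

data Vtx (k : ℕ) : Set where
  u : Vtx k
  w : Vtx k
  v : Fin (3 * k) → Vtx k

CycleStep : (k : ℕ) → Fin (3 * k) → Fin (3 * k) → Set
CycleStep k i j = (suc (toℕ i) ≡ toℕ j) ⊎ ((suc (toℕ i) ≡ 3 * k) × (toℕ j ≡ 0))

AdjG : (k : ℕ) → Vtx k → Vtx k → Set
AdjG k u u = ⊥
AdjG k u w = ⊥
AdjG k u (v i) = (toℕ i % 3 ≡ 1) ⊎ (toℕ i % 3 ≡ 2)
AdjG k w u = ⊥
AdjG k w w = ⊥
AdjG k w (v i) = (toℕ i % 3 ≡ 0) ⊎ (toℕ i % 3 ≡ 1)
AdjG k (v i) u = (toℕ i % 3 ≡ 1) ⊎ (toℕ i % 3 ≡ 2)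
AdjG k (v i) w = (toℕ i % 3 ≡ 0) ⊎ (toℕ i % 3 ≡ 1)
AdjG k (v i) (v j) = CycleStep k i j ⊎ CycleStep k j i

-- In a proper 3-colouring f of G_k the hubs u and w get different colours: otherwise the
-- whole rim v_0 … v_{3k-1}, each vertex of which is adjacent to u or w, would be properly
-- coloured by the two remaining colours, impossible for an odd cycle.  Once f u ≠ f w the
-- rim is forced: v_i with i ≡ 1 sees both hubs and takes the third colour, v_i with i ≡ 2
-- then sees u and v_{i-1}, and v_i with i ≡ 0 sees w and v_{i+1}.  So f is a renaming of a
-- single reference colouring, and u, v_1, v_2 form a triangle.
module Submission where

open import Defs
open import Data.Nat using (ℕ; zero; suc; _≤_; _%_; _+_; _*_; NonZero)
open import Data.Nat.Properties using (m≤n⇒m<n∨m≡n; m*n≢0; 1+n≰n)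
open import Data.Nat.DivMod
  using (_mod_; %-distribˡ-+; %-distribˡ-*; m%n%n≡m%n; m%n<n; m<n⇒m%n≡m; n%n≡0; [m+n]%n≡m%n; m∣n⇒o%n%m≡o%m)
open import Data.Nat.Divisibility using (m∣m*n; n∣m⇒m%n≡0)
open import Data.Fin using (Fin; toℕ; _≟_)
open import Data.Fin.Properties using (injective⇒≤; toℕ-injective; toℕ-fromℕ<; toℕ<n)
open import Data.Fin.Patterns using (0F; 1F; 2F; 3F)
open import Data.Fin.Permutation using (Permutation′; _⟨$⟩ʳ_; _⟨$⟩ˡ_; permutation; flip; _∘ₚ_; inverseˡ)
open import Data.Vec.Functional using ([]; _∷_)
open import Data.Product using (∃; _×_; _,_)
open import Data.Sum using (_⊎_; inj₁; inj₂)
open import Data.Empty using (⊥-elim)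
open import Function using (_∘′_)
open import Function.Definitions using (Injective)
open import Relation.Nullary using (yes; no)
open import Relation.Binary.PropositionalEquality
  using (_≡_; _≢_; refl; sym; trans; cong; subst; module ≡-Reasoning)

three-distinct⇒3≤ : ∀ {c} {x y z : Fin c} → x ≢ y → x ≢ z → y ≢ z → 3 ≤ c
three-distinct⇒3≤ {x = x} {y} {z} x≢y x≢z y≢z = injective⇒≤ {f = x ∷ y ∷ z ∷ []} injective
  where
  injective : Injective _≡_ _≡_ (x ∷ y ∷ z ∷ [])
  injective {0F} {0F} _ = refl
  injective {0F} {1F} e = ⊥-elim (x≢y e)
  injective {0F} {2F} e = ⊥-elim (x≢z e)
  injective {1F} {0F} e = ⊥-elim (x≢y (sym e))
  injective {1F} {1F} _ = refl
  injective {1F} {2F} e = ⊥-elim (y≢z e)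
  injective {2F} {0F} e = ⊥-elim (x≢z (sym e))
  injective {2F} {1F} e = ⊥-elim (y≢z (sym e))
  injective {2F} {2F} _ = refl

four-distinct⇒4≤ : ∀ {c} {a b x y : Fin c} →
                   a ≢ b → x ≢ a → x ≢ b → y ≢ a → y ≢ b → x ≢ y → 4 ≤ c
four-distinct⇒4≤ {a = a} {b} {x} {y} a≢b x≢a x≢b y≢a y≢b x≢y =
  injective⇒≤ {f = a ∷ b ∷ x ∷ y ∷ []} injective
  where
  injective : Injective _≡_ _≡_ (a ∷ b ∷ x ∷ y ∷ [])
  injective {0F} {0F} _ = refl
  injective {0F} {1F} e = ⊥-elim (a≢b e)
  injective {0F} {2F} e = ⊥-elim (x≢a (sym e))
  injective {0F} {3F} e = ⊥-elim (y≢a (sym e))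
  injective {1F} {0F} e = ⊥-elim (a≢b (sym e))
  injective {1F} {1F} _ = refl
  injective {1F} {2F} e = ⊥-elim (x≢b (sym e))
  injective {1F} {3F} e = ⊥-elim (y≢b (sym e))
  injective {2F} {0F} e = ⊥-elim (x≢a e)
  injective {2F} {1F} e = ⊥-elim (x≢b e)
  injective {2F} {2F} _ = refl
  injective {2F} {3F} e = ⊥-elim (x≢y e)
  injective {3F} {0F} e = ⊥-elim (y≢a e)
  injective {3F} {1F} e = ⊥-elim (y≢b e)
  injective {3F} {2F} e = ⊥-elim (x≢y (sym e))
  injective {3F} {3F} _ = refl

avoiding-two-colours-unique : {a b x y : Fin 3} →
                              a ≢ b → x ≢ a → x ≢ b → y ≢ a → y ≢ b → x ≡ y
avoiding-two-colours-unique {x = x} {y} a≢b x≢a x≢b y≢a y≢b with x ≟ y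
... | yes x≡y = x≡y
... | no x≢y = ⊥-elim (1+n≰n (four-distinct⇒4≤ a≢b x≢a x≢b y≢a y≢b x≢y))

module _ {a b c : Fin 3} (a≢b : a ≢ b) (a≢c : a ≢ c) (b≢c : b ≢ c) where

  private
    index : Fin 3 → Fin 3
    index y with y ≟ a | y ≟ b
    ... | yes _ | _     = 0F
    ... | no _  | yes _ = 1F
    ... | no _  | no _  = 2F

    lookup∘index : ∀ y → (a ∷ b ∷ c ∷ []) (index y) ≡ y
    lookup∘index y with y ≟ a | y ≟ b
    ... | yes y≡a | _       = sym y≡a
    ... | no _    | yes y≡b = sym y≡b
    ... | no y≢a  | no y≢b  = avoiding-two-colours-unique a≢b (a≢c ∘′ sym) (b≢c ∘′ sym) y≢a y≢b

    index∘lookup : ∀ i → index ((a ∷ b ∷ c ∷ []) i) ≡ i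
    index∘lookup 0F with a ≟ a
    ... | yes _   = refl
    ... | no a≢a  = ⊥-elim (a≢a refl)
    index∘lookup 1F with b ≟ a | b ≟ b
    ... | yes b≡a | _       = ⊥-elim (a≢b (sym b≡a))
    ... | no _    | yes _   = refl
    ... | no _    | no b≢b  = ⊥-elim (b≢b refl)
    index∘lookup 2F with c ≟ a | c ≟ b
    ... | yes c≡a | _       = ⊥-elim (a≢c (sym c≡a))
    ... | no _    | yes c≡b = ⊥-elim (b≢c (sym c≡b))
    ... | no _    | no _    = refl

  three-distinct⇒permutation : Permutation′ 3
  three-distinct⇒permutation = permutation (a ∷ b ∷ c ∷ []) index lookup∘index index∘lookup

_IsRecolouringOf_ : {V : Set} {c : ℕ} → (V → Fin c) → (V → Fin c) → Set
_IsRecolouringOf_ {V} {c} g f = ∃ λ (π : Permutation′ c) → (x : V) → g x ≡ π ⟨$⟩ʳ f x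

module _ {V : Set} {c : ℕ} where

  recolouring-sym : {f g : V → Fin c} → g IsRecolouringOf f → f IsRecolouringOf g
  recolouring-sym {f} {g} (π , g≡πf) = flip π , λ x → begin
    f x                   ≡⟨ inverseˡ π ⟨
    π ⟨$⟩ˡ (π ⟨$⟩ʳ f x)   ≡⟨ cong (π ⟨$⟩ˡ_) (g≡πf x) ⟨
    π ⟨$⟩ˡ g x            ∎
    where open ≡-Reasoning

  recolouring-trans : {f g h : V → Fin c} →
                      h IsRecolouringOf g → g IsRecolouringOf f → h IsRecolouringOf f
  recolouring-trans (ρ , h≡ρg) (σ , g≡σf) = σ ∘ₚ ρ , λ x → trans (h≡ρg x) (cong (ρ ⟨$⟩ʳ_) (g≡σf x))

[1+m]%n≡[1+m%n]%n : ∀ m n .{{_ : NonZero n}} → suc m % n ≡ suc (m % n) % n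
[1+m]%n≡[1+m%n]%n m n = begin
  (1 + m) % n                ≡⟨ %-distribˡ-+ 1 m n ⟩
  (1 % n + m % n) % n        ≡⟨ cong (λ r → (1 % n + r) % n) (m%n%n≡m%n m n) ⟨
  (1 % n + m % n % n) % n    ≡⟨ %-distribˡ-+ 1 (m % n) n ⟨
  (1 + m % n) % n            ∎
  where open ≡-Reasoning

[1+m]%n≡1+[m%n]⊎wraps : ∀ m n .{{_ : NonZero n}} →
                        suc m % n ≡ suc (m % n) ⊎ (suc (m % n) ≡ n × suc m % n ≡ 0)
[1+m]%n≡1+[m%n]⊎wraps m n with m≤n⇒m<n∨m≡n (m%n<n m n)
... | inj₁ 1+r<n = inj₁ (trans ([1+m]%n≡[1+m%n]%n m n) (m<n⇒m%n≡m 1+r<n))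
... | inj₂ 1+r≡n = inj₂ (1+r≡n , trans ([1+m]%n≡[1+m%n]%n m n)
                                       (trans (cong (_% n) 1+r≡n) (n%n≡0 n)))

residue-cases : ∀ n → n % 3 ≡ 0 ⊎ n % 3 ≡ 1 ⊎ n % 3 ≡ 2
residue-cases 0 = inj₁ refl
residue-cases 1 = inj₂ (inj₁ refl)
residue-cases 2 = inj₂ (inj₂ refl)
residue-cases (suc (suc (suc n))) = residue-cases n

residue-pred : ∀ n → suc n % 3 ≡ 2 → n % 3 ≡ 1
residue-pred 0 ()
residue-pred 1 _ = refl
residue-pred 2 ()
residue-pred (suc (suc (suc n))) r = residue-pred n r

residue-suc : ∀ n {r} → n % 3 ≡ r → suc n % 3 ≡ suc r % 3
residue-suc n refl = [1+m]%n≡[1+m%n]%n n 3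

odd⇒3*odd : ∀ k → k % 2 ≡ 1 → 3 * k % 2 ≡ 1
odd⇒3*odd k k-odd = trans (%-distribˡ-* 3 k 2) (cong (λ r → (1 * r) % 2) k-odd)

two-coloured-sequence-alternates : {a : Fin 3} (h : ℕ → Fin 3) →
  (∀ n → h n ≢ a) → (∀ n → h n ≢ h (suc n)) → ∀ n → h n ≡ h (n % 2)
two-coloured-sequence-alternates h avoids-a steps 0 = refl
two-coloured-sequence-alternates h avoids-a steps 1 = refl
two-coloured-sequence-alternates h avoids-a steps (suc (suc n)) =
  trans (avoiding-two-colours-unique (avoids-a (suc n) ∘′ sym) (avoids-a (suc (suc n)))
           (steps (suc n) ∘′ sym) (avoids-a n) (steps n))
        (two-coloured-sequence-alternates h avoids-a steps n)

-- The colours 0, 1, 2 are those of u, of w, and of the rim vertices v_i with i ≡ 1.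
residueColour : ℕ → Fin 3
residueColour 0 = 0F
residueColour 1 = 2F
residueColour _ = 1F

residueColour-suc : ∀ n → residueColour (n % 3) ≢ residueColour (suc n % 3)
residueColour-suc 0 ()
residueColour-suc 1 ()
residueColour-suc 2 ()
residueColour-suc (suc (suc (suc n))) = residueColour-suc n

residueColour≢0F : ∀ {r} → r ≡ 1 ⊎ r ≡ 2 → residueColour r ≢ 0F
residueColour≢0F (inj₁ refl) ()
residueColour≢0F (inj₂ refl) ()

residueColour≢1F : ∀ {r} → r ≡ 0 ⊎ r ≡ 1 → residueColour r ≢ 1F
residueColour≢1F (inj₁ refl) ()
residueColour≢1F (inj₂ refl) ()

referenceColouring : ∀ {k} → Vtx k → Fin 3
referenceColouring u     = 0F
referenceColouring w     = 1F
referenceColouring (v i) = residueColour (toℕ i % 3)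

module _ (k : ℕ) {{_ : NonZero k}} where

  private instance
    3k≢0 : NonZero (3 * k)
    3k≢0 = m*n≢0 3 k

  -- Indexing the rim by ℕ modulo 3k makes the closing edge v_{3k-1} v_0 an ordinary step.
  rimVertex : ℕ → Vtx k
  rimVertex n = v (n mod (3 * k))

  toℕ-rimIndex : ∀ n → toℕ (n mod (3 * k)) ≡ n % (3 * k)
  toℕ-rimIndex n = toℕ-fromℕ< (m%n<n n (3 * k))

  rimVertex-toℕ : ∀ i → rimVertex (toℕ i) ≡ v i
  rimVertex-toℕ i = cong v (toℕ-injective (trans (toℕ-rimIndex (toℕ i)) (m<n⇒m%n≡m (toℕ<n i))))

  rimVertex-period : rimVertex (3 * k) ≡ rimVertex 0
  rimVertex-period = cong v (toℕ-injective (begin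
    toℕ ((3 * k) mod (3 * k))  ≡⟨ toℕ-rimIndex (3 * k) ⟩
    (0 + 3 * k) % (3 * k)      ≡⟨ [m+n]%n≡m%n 0 (3 * k) ⟩
    0 % (3 * k)                ≡⟨ toℕ-rimIndex 0 ⟨
    toℕ (0 mod (3 * k))        ∎))
    where open ≡-Reasoning

  rimVertex-residue : ∀ n → toℕ (n mod (3 * k)) % 3 ≡ n % 3
  rimVertex-residue n =
    trans (cong (_% 3) (toℕ-rimIndex n)) (m∣n⇒o%n%m≡o%m 3 (3 * k) n (m∣m*n k))

  rimVertex-adjacent : ∀ n → AdjG k (rimVertex n) (rimVertex (suc n))
  rimVertex-adjacent n with [1+m]%n≡1+[m%n]⊎wraps n (3 * k)
  ... | inj₁ step =
    inj₁ (inj₁ (trans (cong suc (toℕ-rimIndex n)) (sym (trans (toℕ-rimIndex (suc n)) step))))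
  ... | inj₂ (closes , wraps) =
    inj₁ (inj₂ (trans (cong suc (toℕ-rimIndex n)) closes , trans (toℕ-rimIndex (suc n)) wraps))

  u-adjacent : ∀ {n} → n % 3 ≡ 1 ⊎ n % 3 ≡ 2 → AdjG k u (rimVertex n)
  u-adjacent {n} = subst (λ r → r ≡ 1 ⊎ r ≡ 2) (sym (rimVertex-residue n))

  w-adjacent : ∀ {n} → n % 3 ≡ 0 ⊎ n % 3 ≡ 1 → AdjG k w (rimVertex n)
  w-adjacent {n} = subst (λ r → r ≡ 0 ⊎ r ≡ 1) (sym (rimVertex-residue n))

  colourable⇒3≤ : ∀ {c} → Colorable (AdjG k) c → 3 ≤ c
  colourable⇒3≤ (f , proper) = three-distinct⇒3≤
    (proper u (rimVertex 1) (u-adjacent (inj₁ refl)))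
    (proper u (rimVertex 2) (u-adjacent (inj₂ refl)))
    (proper (rimVertex 1) (rimVertex 2) (rimVertex-adjacent 1))

  cycleStep-residue : ∀ {i j} → CycleStep k i j → toℕ j % 3 ≡ suc (toℕ i) % 3
  cycleStep-residue (inj₁ step) = cong (_% 3) (sym step)
  cycleStep-residue (inj₂ (closes , j≡0)) =
    trans (cong (_% 3) j≡0) (sym (trans (cong (_% 3) closes) (n∣m⇒m%n≡0 (3 * k) 3 (m∣m*n k))))

  residueColour-cycleStep : ∀ {i j} → CycleStep k i j →
                            residueColour (toℕ i % 3) ≢ residueColour (toℕ j % 3)
  residueColour-cycleStep {i} step = subst (λ r → residueColour (toℕ i % 3) ≢ residueColour r)
                                           (sym (cycleStep-residue step)) (residueColour-suc (toℕ i))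

  referenceColouring-proper : IsProperColoring (AdjG k) 3 referenceColouring
  referenceColouring-proper u     (v i) adj         = residueColour≢0F adj ∘′ sym
  referenceColouring-proper (v i) u     adj         = residueColour≢0F adj
  referenceColouring-proper w     (v i) adj         = residueColour≢1F adj ∘′ sym
  referenceColouring-proper (v i) w     adj         = residueColour≢1F adj
  referenceColouring-proper (v i) (v j) (inj₁ step) = residueColour-cycleStep step
  referenceColouring-proper (v i) (v j) (inj₂ step) = residueColour-cycleStep step ∘′ sym

  module _ (f : Vtx k → Fin 3) (proper : IsProperColoring (AdjG k) 3 f) where

    rim : ℕ → Fin 3
    rim n = f (rimVertex n)

    rim-avoids-u : ∀ {n} → n % 3 ≡ 1 ⊎ n % 3 ≡ 2 → rim n ≢ f u
    rim-avoids-u r = proper u _ (u-adjacent r) ∘′ sym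

    rim-avoids-w : ∀ {n} → n % 3 ≡ 0 ⊎ n % 3 ≡ 1 → rim n ≢ f w
    rim-avoids-w r = proper w _ (w-adjacent r) ∘′ sym

    rim-step : ∀ n → rim n ≢ rim (suc n)
    rim-step n = proper _ _ (rimVertex-adjacent n)

    hubs-differ : k % 2 ≡ 1 → f u ≢ f w
    hubs-differ k-odd fu≡fw = rim-step 0 (begin
      rim 0                ≡⟨ cong f rimVertex-period ⟨
      rim (3 * k)          ≡⟨ two-coloured-sequence-alternates rim rim-avoids-hubs rim-step (3 * k) ⟩
      rim (3 * k % 2)      ≡⟨ cong rim (odd⇒3*odd k k-odd) ⟩
      rim 1                ∎)
      where
      open ≡-Reasoning
      rim-avoids-hubs : ∀ n → rim n ≢ f u
      rim-avoids-hubs n with residue-cases n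
      ... | inj₁ r        = subst (rim n ≢_) (sym fu≡fw) (rim-avoids-w (inj₁ r))
      ... | inj₂ (inj₁ r) = rim-avoids-u (inj₁ r)
      ... | inj₂ (inj₂ r) = rim-avoids-u (inj₂ r)

    module _ (fu≢fw : f u ≢ f w) where

      private
        fu≢rim1 : f u ≢ rim 1
        fu≢rim1 = proper u (rimVertex 1) (u-adjacent (inj₁ refl))

        fw≢rim1 : f w ≢ rim 1
        fw≢rim1 = proper w (rimVertex 1) (w-adjacent (inj₂ refl))

      rim-residue1 : ∀ {n} → n % 3 ≡ 1 → rim n ≡ rim 1
      rim-residue1 r = avoiding-two-colours-unique fu≢fw
        (rim-avoids-u (inj₁ r)) (rim-avoids-w (inj₂ r)) (fu≢rim1 ∘′ sym) (fw≢rim1 ∘′ sym)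

      rim-residue2 : ∀ {n} → n % 3 ≡ 2 → rim n ≡ f w
      rim-residue2 {suc n} r = avoiding-two-colours-unique fu≢rim1
        (rim-avoids-u (inj₂ r)) (λ e → rim-step n (trans (rim-residue1 (residue-pred n r)) (sym e)))
        (fu≢fw ∘′ sym) fw≢rim1

      rim-residue0 : ∀ {n} → n % 3 ≡ 0 → rim n ≡ f u
      rim-residue0 {n} r = avoiding-two-colours-unique fw≢rim1
        (rim-avoids-w (inj₁ r)) (λ e → rim-step n (trans e (sym (rim-residue1 (residue-suc n r)))))
        fu≢fw fu≢rim1

      colours : Permutation′ 3
      colours = three-distinct⇒permutation fu≢fw fu≢rim1 fw≢rim1

      rim-by-residue : ∀ n → rim n ≡ colours ⟨$⟩ʳ residueColour (n % 3)
      rim-by-residue n with residue-cases n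
      ... | inj₁ r        rewrite r = rim-residue0 r
      ... | inj₂ (inj₁ r) rewrite r = rim-residue1 r
      ... | inj₂ (inj₂ r) rewrite r = rim-residue2 r

      recolouring-of-reference : f IsRecolouringOf referenceColouring
      recolouring-of-reference = colours , λ where
        u     → refl
        w     → refl
        (v i) → trans (cong f (sym (rimVertex-toℕ i))) (rim-by-residue (toℕ i))

theorem3p1 : (k : ℕ) → 3 ≤ k → k % 2 ≡ 1 → UniquelyColorable (AdjG k) 3
theorem3p1 zero () _
theorem3p1 k@(suc _) _ k-odd =
  ((referenceColouring , referenceColouring-proper k) , λ _ → colourable⇒3≤ k) ,
  λ f g f-proper g-proper →
    recolouring-trans (from-reference g g-proper) (recolouring-sym (from-reference f f-proper))
  where
  from-reference : ∀ f → IsProperColoring (AdjG k) 3 f → f IsRecolouringOf referenceColouring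
  from-reference f proper = recolouring-of-reference k f proper (hubs-differ k f proper k-odd)
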